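{- Let $a\ge 2$ and $b\ge 2$ be integers. Then there is a finite simple connected graph $G$ with $\mathrm{gp}^-(G)=a$ and $g(G)=b$ if and only if $2\le a\le b$ or $4\le b\le a$.
   Context: A set $S$ of vertices of a connected graph $G$ is a general position set if no shortest path contains three or more vertices of $S$; it is maximal if not properly contained in another general position set; $\mathrm{gp}^-(G)$ is the number of vertices in a smallest maximal general position set. The interval $I[u,v]$ is the set of vertices lying on some shortest $u,v$-path; $S$ is geodetic if $\bigcup_{u,v\in S}I[u,v]=V(G)$; the geodetic number $g(G)$ is the size of a smallest geodetic set. -}

module Defs where

open import Data.Nat using (ℕ; zero; suc; _≤_)
open import Data.Bool using (Bool; true; false)
open import Data.Fin using (Fin)
open import Data.Fin.Subset using (Subset; _∈_; _⊆_; ∣_∣)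
open import Data.Product using (Σ; ∃; _×_; _,_)
open import Relation.Binary.PropositionalEquality using (_≡_)
open import Relation.Nullary using (¬_)

record Graph : Set where
  field
    n     : ℕ
    adj   : Fin n → Fin n → Bool
    sym   : ∀ u v → adj u v ≡ adj v u
    irrefl : ∀ u → adj u u ≡ false

module _ (G : Graph) where
  open Graph G

  data Walk : Fin n → Fin n → ℕ → Set where
    nil  : ∀ {u} → Walk u u zero
    cons : ∀ {u w v k} → adj u w ≡ true → Walk w v k → Walk u v (suc k)

  data OnWalk (x : Fin n) : ∀ {u v k} → Walk u v k → Set where
    here  : ∀ {v k} {W : Walk x v k} → OnWalk x W
    there : ∀ {u w v k} {e : adj u w ≡ true} {W : Walk w v k} →
            OnWalk x W → OnWalk x (cons e W)

  Connected : Set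
  Connected = ∀ u v → ∃ λ k → Walk u v k

  -- A shortest u,v-path: a u,v-walk of minimum length
  -- (such a walk has no repeated vertices, so it is a path).
  Shortest : ∀ {u v k} → Walk u v k → Set
  Shortest {u} {v} {k} _ = ∀ k' → Walk u v k' → k ≤ k'

  GenPos : Subset n → Set
  GenPos S = ∀ u v k (P : Walk u v k) → Shortest P →
    ¬ (Σ (Fin n) λ x → Σ (Fin n) λ y → Σ (Fin n) λ z →
         ¬ x ≡ y × ¬ x ≡ z × ¬ y ≡ z ×
         x ∈ S × y ∈ S × z ∈ S ×
         OnWalk x P × OnWalk y P × OnWalk z P)

  MaximalGenPos : Subset n → Set
  MaximalGenPos S = GenPos S × (∀ T → S ⊆ T → GenPos T → T ⊆ S)

  GpMinus : ℕ → Set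
  GpMinus a = (Σ (Subset n) λ S → MaximalGenPos S × ∣ S ∣ ≡ a)
            × (∀ S → MaximalGenPos S → a ≤ ∣ S ∣)

  InInterval : Fin n → Fin n → Fin n → Set
  InInterval u v w = Σ ℕ λ k → Σ (Walk u v k) λ P → Shortest P × OnWalk w P

  Geodetic : Subset n → Set
  Geodetic S = ∀ w → Σ (Fin n) λ u → Σ (Fin n) λ v →
                 u ∈ S × v ∈ S × InInterval u v w

  GeodeticNumber : ℕ → Set
  GeodeticNumber b = (Σ (Subset n) λ S → Geodetic S × ∣ S ∣ ≡ b)
                   × (∀ S → Geodetic S → b ≤ ∣ S ∣)

-- If g(G) ≤ 3, a minimum geodetic set S is in general position: trivially when |S| ≤ 2, and when
-- |S| = 3 because if its three vertices lay on one geodesic, the middle one would lie in the interval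
-- of the other two, which would then already form a geodetic set. A geodetic set in general position
-- is maximal (any further vertex lies strictly inside an interval of S), so gp⁻(G) ≤ g(G). Hence
-- gp⁻(G) > g(G) forces g(G) ≥ 4.
--
-- Conversely, both constructions have diameter two, where general position means spanning no induced
-- P₃ and intervals consist of the endpoints and the middles of induced P₃s. For a ≤ b take a clique
-- K_{a-1} joined to b independent vertices; for 4 ≤ b ≤ a take the complete a-partite graph with parts
-- of size a + 1 and add b - 4 vertices adjacent exactly to the first vertex of each part.

module Submission where

open import Defs
open import Data.Bool using (Bool; true; false; not)
open import Data.Empty using (⊥-elim)
open import Data.Fin using (Fin; zero; suc)
open import Data.Fin.Patterns using (0F; 1F; 2F; 3F)
open import Data.Fin.Properties using (_≟_; any?; suc-injective; +↔⊎; *↔×)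
open import Data.Fin.Subset using (Subset; _∈_; _∉_; _⊆_; ∣_∣; _-_; ⁅_⁆; _∪_; ⊥; inside; outside)
open import Data.Fin.Subset.Properties
  using ( _∈?_; ∉⊥; x∈⁅x⁆; x∈⁅y⁆⇒x≡y; x∈p∪q⁻; x∈p∪q⁺; p⊆p∪q; p─q⊆p; x∈p∧x≢y⇒x∈p-y
        ; Empty-unique; ∣⊥∣≡0; p─⊥≡p; x∈p⇒∣p-x∣<∣p∣)
open import Data.List using (List; []; _∷_; _++_; length; tabulate)
open import Data.List.Membership.Propositional using () renaming (_∈_ to _∈ₗ_)
open import Data.List.Membership.Propositional.Properties using (∈-map⁻; ∈-tabulate⁺; ∈-tabulate⁻; ∈-++⁻)
open import Data.List.Properties using (length-map; length-tabulate; length-++)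
open import Data.List.Relation.Binary.Disjoint.Propositional using (Disjoint)
open import Data.List.Relation.Unary.All as All using ([]; _∷_)
open import Data.List.Relation.Unary.All.Properties using (¬Any⇒All¬)
open import Data.List.Relation.Unary.AllPairs using ([]; _∷_)
open import Data.List.Relation.Unary.Any as Any using (here; there)
open import Data.List.Relation.Unary.Any.Properties using (¬Any[])
open import Data.List.Relation.Unary.Unique.Propositional using (Unique)
import Data.List.Relation.Unary.Unique.Propositional.Properties as Unique
open import Data.Nat using (ℕ; zero; suc; _+_; _*_; _≤_; _<_; _≤?_; z≤n; s≤s)
open import Data.Nat.Properties
  using ( ≤-reflexive; ≤-trans; ≤-antisym; ≤-pred; <⇒≤; <⇒≢; <⇒≱; ≰⇒>; m≤n⇒m<n∨m≡n; m≤n⇒m≤1+n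
        ; m≤m+n; +-monoˡ-≤; +-cancelʳ-≤)
open import Data.Product using (Σ; _×_; _,_; proj₁; proj₂)
open import Data.Product.Properties using (,-injectiveˡ; ,-injectiveʳ)
open import Data.Sum using (_⊎_; inj₁; inj₂; [_,_]′)
open import Data.Sum.Function.Propositional using (_⊎-↔_)
open import Data.Sum.Properties using (inj₁-injective; inj₂-injective)
open import Data.Vec as Vec using (_∷_)
open import Function using (_∘_)
open import Function.Bundles using (_↔_; _⇔_; mk⇔; Inverse)
open import Function.Properties.Inverse using (↔-refl; ↔-trans)
open import Relation.Binary.PropositionalEquality using (_≡_; _≢_; refl; sym; trans; cong; cong₂; subst)
open import Relation.Nullary using (¬_; ¬?; Dec; yes; no; does; _×-dec_)
open import Relation.Nullary.Decidable using (dec-true; dec-false; map′)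

Realizes : ℕ → ℕ → Set
Realizes a b = Σ Graph λ G → Connected G × GpMinus G a × GeodeticNumber G b

x∉p-x : ∀ {n} (p : Subset n) x → x ∉ p - x
x∉p-x (_ ∷ p) zero    ()
x∉p-x (_ ∷ p) (suc x) (Vec.there x∈p-x) = x∉p-x p x x∈p-x

∣p∣≤1+∣p-x∣ : ∀ {n} (p : Subset n) x → ∣ p ∣ ≤ suc ∣ p - x ∣
∣p∣≤1+∣p-x∣ (inside  ∷ p) zero    = s≤s (≤-reflexive (cong ∣_∣ (sym (p─⊥≡p p))))
∣p∣≤1+∣p-x∣ (outside ∷ p) zero    = m≤n⇒m≤1+n (≤-reflexive (cong ∣_∣ (sym (p─⊥≡p p))))
∣p∣≤1+∣p-x∣ (inside  ∷ p) (suc x) = s≤s (∣p∣≤1+∣p-x∣ p x)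
∣p∣≤1+∣p-x∣ (outside ∷ p) (suc x) = ∣p∣≤1+∣p-x∣ p x

∣p∣≤length : ∀ {n} {p : Subset n} xs → (∀ {x} → x ∈ p → x ∈ₗ xs) → ∣ p ∣ ≤ length xs
∣p∣≤length {n} {p} [] p⊆[] =
  ≤-reflexive (trans (cong ∣_∣ (Empty-unique λ (_ , x∈p) → ¬Any[] (p⊆[] x∈p))) (∣⊥∣≡0 n))
∣p∣≤length {p = p} (x ∷ xs) p⊆x∷xs = ≤-trans (∣p∣≤1+∣p-x∣ p x) (s≤s (∣p∣≤length xs p-x⊆xs))
  where
  p-x⊆xs : ∀ {y} → y ∈ p - x → y ∈ₗ xs
  p-x⊆xs {y} y∈p-x with p⊆x∷xs (p─q⊆p p ⁅ x ⁆ y∈p-x)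
  ... | here refl  = ⊥-elim (x∉p-x p x y∈p-x)
  ... | there y∈xs = y∈xs

length≤∣p∣ : ∀ {n} {p : Subset n} {xs} → Unique xs → (∀ {x} → x ∈ₗ xs → x ∈ p) → length xs ≤ ∣ p ∣
length≤∣p∣ {xs = []}     _                  _        = z≤n
length≤∣p∣ {p = p} {x ∷ xs} (x∉xs ∷ xs-unique) xs⊆p =
  ≤-trans (s≤s (length≤∣p∣ xs-unique xs⊆p-x)) (x∈p⇒∣p-x∣<∣p∣ (xs⊆p (here refl)))
  where
  xs⊆p-x : ∀ {y} → y ∈ₗ xs → y ∈ p - x
  xs⊆p-x y∈xs = x∈p∧x≢y⇒x∈p-y (xs⊆p (there y∈xs)) (λ y≡x → All.lookup x∉xs y∈xs (sym y≡x))

∣p∣≤length⇒⊆ : ∀ {n} {p : Subset n} {xs} → Unique xs → (∀ {x} → x ∈ₗ xs → x ∈ p) → ∣ p ∣ ≤ length xs →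
               ∀ {y} → y ∈ p → y ∈ₗ xs
∣p∣≤length⇒⊆ {p = p} {xs} xs-unique xs⊆p ∣p∣≤ {y} y∈p with Any.any? (y ≟_) xs
... | yes y∈xs = y∈xs
... | no  y∉xs = ⊥-elim (<⇒≱ (length≤∣p∣ (¬Any⇒All¬ xs y∉xs ∷ xs-unique) y∷xs⊆p) ∣p∣≤)
  where
  y∷xs⊆p : ∀ {x} → x ∈ₗ y ∷ xs → x ∈ p
  y∷xs⊆p (here refl)  = y∈p
  y∷xs⊆p (there x∈xs) = xs⊆p x∈xs

fromList : ∀ {n} → List (Fin n) → Subset n
fromList []       = ⊥
fromList (x ∷ xs) = ⁅ x ⁆ ∪ fromList xs

∈-fromList⁺ : ∀ {n} {x : Fin n} {xs} → x ∈ₗ xs → x ∈ fromList xs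
∈-fromList⁺ {x = x} (here refl)        = x∈p∪q⁺ (inj₁ (x∈⁅x⁆ x))
∈-fromList⁺                 (there x∈xs) = x∈p∪q⁺ (inj₂ (∈-fromList⁺ x∈xs))

∈-fromList⁻ : ∀ {n} {x : Fin n} xs → x ∈ fromList xs → x ∈ₗ xs
∈-fromList⁻ []       x∈⊥ = ⊥-elim (∉⊥ x∈⊥)
∈-fromList⁻ (y ∷ xs) x∈  = [ here ∘ x∈⁅y⁆⇒x≡y y , there ∘ ∈-fromList⁻ xs ]′ (x∈p∪q⁻ ⁅ y ⁆ _ x∈)

∣fromList∣≤length : ∀ {n} (xs : List (Fin n)) → ∣ fromList xs ∣ ≤ length xs
∣fromList∣≤length xs = ∣p∣≤length xs (∈-fromList⁻ xs)

record InducedP₃ {A : Set} (adj : A → A → Bool) (u m v : A) : Set where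
  constructor induced
  field
    adjˡ          : adj u m ≡ true
    adjʳ          : adj m v ≡ true
    nonadjacent   : adj u v ≡ false
    ends-distinct : u ≢ v

P₃-Free : {A : Set} → (A → A → Bool) → (A → Set) → Set
P₃-Free adj S = ∀ {u m v} → S u → S m → S v → ¬ InducedP₃ adj u m v

Covered : {A : Set} → (A → A → Bool) → (A → Set) → A → Set
Covered adj S w = S w ⊎ Σ _ λ u → Σ _ λ v → S u × S v × InducedP₃ adj u w v

record Embedding {A B : Set} (adjA : A → A → Bool) (adjB : B → B → Bool) (f : A → B) : Set where
  field
    adj-preserving : ∀ x y → adjB (f x) (f y) ≡ adjA x y
    injective      : ∀ {x y} → f x ≡ f y → x ≡ y

module _ {A B : Set} {adjA : A → A → Bool} {adjB : B → B → Bool} {f : A → B}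
         (emb : Embedding adjA adjB f) where
  open Embedding emb

  P₃-map : ∀ {u m v} → InducedP₃ adjA u m v → InducedP₃ adjB (f u) (f m) (f v)
  P₃-map {u} {m} {v} (induced u~m m~v u≁v u≢v) =
    induced (trans (adj-preserving u m) u~m) (trans (adj-preserving m v) m~v)
            (trans (adj-preserving u v) u≁v) (u≢v ∘ injective)

  P₃-Free-pullback : ∀ {S} → P₃-Free adjB S → P₃-Free adjA (S ∘ f)
  P₃-Free-pullback S-free u∈S m∈S v∈S = S-free u∈S m∈S v∈S ∘ P₃-map

  Covered-push : ∀ {S x} → Covered adjA (S ∘ f) x → Covered adjB S (f x)
  Covered-push (inj₁ x∈S)                   = inj₁ x∈S
  Covered-push (inj₂ (u , v , u∈S , v∈S , p)) = inj₂ (f u , f v , u∈S , v∈S , P₃-map p)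

module _ {A : Set} {adj : A → A → Bool} where

  P₃-Free-mono : ∀ {S T} → (∀ {x} → T x → S x) → P₃-Free adj S → P₃-Free adj T
  P₃-Free-mono T⊆S S-free u∈T m∈T v∈T = S-free (T⊆S u∈T) (T⊆S m∈T) (T⊆S v∈T)

  Covered-mono : ∀ {S T x} → (∀ {y} → S y → T y) → Covered adj S x → Covered adj T x
  Covered-mono S⊆T (inj₁ x∈S)                   = inj₁ (S⊆T x∈S)
  Covered-mono S⊆T (inj₂ (u , v , u∈S , v∈S , p)) = inj₂ (u , v , S⊆T u∈S , S⊆T v∈S , p)

  module _ (adj-irrefl : ∀ x → adj x x ≡ false) (adj-sym : ∀ x y → adj x y ≡ adj y x) where

    P₃-reverse : ∀ {u m v} → InducedP₃ adj u m v → InducedP₃ adj v m u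
    P₃-reverse {u} {m} {v} (induced u~m m~v u≁v u≢v) =
      induced (trans (adj-sym v m) m~v) (trans (adj-sym m u) u~m) (trans (adj-sym v u) u≁v) (u≢v ∘ sym)

    no-loop : ∀ {x} → ¬ adj x x ≡ true
    no-loop {x} x~x with () ← trans (sym x~x) (adj-irrefl x)

    P₃-extend : ∀ {S w} → P₃-Free adj S →
                (∀ {u v} → S u → S v → ¬ InducedP₃ adj u w v) →
                (∀ {m v} → S m → S v → ¬ InducedP₃ adj w m v) →
                P₃-Free adj (λ x → S x ⊎ x ≡ w)
    P₃-extend S-free not-middle not-end = extended
      where
      extended : P₃-Free adj _
      extended _           (inj₂ refl) (inj₂ refl) p = no-loop (InducedP₃.adjʳ p)
      extended (inj₂ refl) (inj₂ refl) _           p = no-loop (InducedP₃.adjˡ p)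
      extended (inj₂ refl) (inj₁ _)    (inj₂ refl) p = InducedP₃.ends-distinct p refl
      extended (inj₁ u∈S)  (inj₂ refl) (inj₁ v∈S)  p = not-middle u∈S v∈S p
      extended (inj₂ refl) (inj₁ m∈S)  (inj₁ v∈S)  p = not-end m∈S v∈S p
      extended (inj₁ u∈S)  (inj₁ m∈S)  (inj₂ refl) p = not-end m∈S u∈S (P₃-reverse p)
      extended (inj₁ u∈S)  (inj₁ m∈S)  (inj₁ v∈S)  p = S-free u∈S m∈S v∈S p

-- Walks, shortest paths and intervals

module Geodesics (G : Graph) where
  open Graph G using (n; adj) renaming (sym to adj-sym)

  infix 4 _∈I[_,_]
  _∈I[_,_] : Fin n → Fin n → Fin n → Set
  w ∈I[ u , v ] = InInterval G u v w

  private variable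
    u v w x y z : Fin n
    a b k : ℕ

  infixr 5 _++ʷ_
  _++ʷ_ : Walk G u w a → Walk G w v b → Walk G u v (a + b)
  nil      ++ʷ Q = Q
  cons e P ++ʷ Q = cons e (P ++ʷ Q)

  ∈-++ʷˡ : {P : Walk G u w a} (Q : Walk G w v b) → OnWalk G x P → OnWalk G x (P ++ʷ Q)
  ∈-++ʷˡ {P = nil}      Q here       = here
  ∈-++ʷˡ {P = cons e P} Q here       = here
  ∈-++ʷˡ {P = cons e P} Q (there x∈P) = there (∈-++ʷˡ Q x∈P)

  end∈ : (P : Walk G u v k) → OnWalk G v P
  end∈ nil        = here
  end∈ (cons e P) = there (end∈ P)

  snoc : Walk G u w k → adj w v ≡ true → Walk G u v (suc k)
  snoc nil         e = cons e nil
  snoc (cons e′ P) e = cons e′ (snoc P e)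

  ∈-snoc : (P : Walk G u w k) (e : adj w v ≡ true) → OnWalk G x P → OnWalk G x (snoc P e)
  ∈-snoc nil         e here        = here
  ∈-snoc (cons e′ P) e here        = here
  ∈-snoc (cons e′ P) e (there x∈P) = there (∈-snoc P e x∈P)

  reverse : Walk G u v k → Walk G v u k
  reverse nil                = nil
  reverse (cons {u} {w} e P) = snoc (reverse P) (trans (adj-sym w u) e)

  ∈-reverse : (P : Walk G u v k) → OnWalk G x P → OnWalk G x (reverse P)
  ∈-reverse nil        here        = here
  ∈-reverse (cons e P) here        = end∈ (reverse (cons e P))
  ∈-reverse (cons e P) (there x∈P) = ∈-snoc (reverse P) _ (∈-reverse P x∈P)

  reverse-shortest : (P : Walk G u v k) → Shortest G P → Shortest G (reverse P)
  reverse-shortest P P-sh k′ Q = P-sh k′ (reverse Q)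

  tail-shortest : (e : adj u w ≡ true) (P : Walk G w v k) → Shortest G (cons e P) → Shortest G P
  tail-shortest e P P-sh k′ Q = ≤-pred (P-sh (suc k′) (cons e Q))

  record Split (u z v : Fin n) (k : ℕ) : Set where
    constructor split
    field
      {i j}      : ℕ
      prefix     : Walk G u z i
      suffix     : Walk G z v j
      length-sum : i + j ≡ k
  open Split

  split-cons : adj u w ≡ true → Split w z v k → Split u z v (suc k)
  split-cons e (split Q R eq) = split (cons e Q) R (cong suc eq)

  split-at : {P : Walk G u v k} → OnWalk G z P → Split u z v k
  split-at {P = P}        here        = split nil P refl
  split-at {P = cons e P} (there z∈P) = split-cons e (split-at z∈P)

  PrefixThrough : Walk G u v k → Fin n → Fin n → Set
  PrefixThrough {u} {v} {k} P y z = Σ (Split u z v k) λ s → OnWalk G y (prefix s)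

  prefix-through : {P : Walk G u v k} → OnWalk G y P → OnWalk G z P →
                   PrefixThrough P y z ⊎ PrefixThrough P z y
  prefix-through here z∈P = inj₁ (split-at z∈P , here)
  prefix-through {P = cons e P} (there y∈P) here = inj₂ (split-at {P = cons e P} (there y∈P) , here)
  prefix-through {P = cons e P} (there y∈P) (there z∈P) with prefix-through y∈P z∈P
  ... | inj₁ (s , y∈Q) = inj₁ (split-cons e s , there y∈Q)
  ... | inj₂ (s , z∈Q) = inj₂ (split-cons e s , there z∈Q)

  prefix-shortest : (P : Walk G u v k) → Shortest G P → (s : Split u z v k) → Shortest G (prefix s)
  prefix-shortest P P-sh (split {i} {j} Q R refl) i′ Q′ = +-cancelʳ-≤ j i i′ (P-sh _ (Q′ ++ʷ R))

  I-sym : w ∈I[ u , v ] → w ∈I[ v , u ]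
  I-sym (k , P , P-sh , w∈P) = k , reverse P , reverse-shortest P P-sh , ∈-reverse P w∈P

  I-start : w ∈I[ u , v ] → u ∈I[ u , v ]
  I-start (k , P , P-sh , _) = k , P , P-sh , here

  I-end : w ∈I[ u , v ] → v ∈I[ u , v ]
  I-end (k , P , P-sh , _) = k , P , P-sh , end∈ P

  I-self : w ∈I[ u , u ] → w ≡ u
  I-self (k , P , P-sh , w∈P) = on-trivial P (P-sh 0 nil) w∈P
    where
    on-trivial : (P : Walk G u u k) → k ≤ 0 → OnWalk G w P → w ≡ u
    on-trivial nil z≤n here = refl

  I-trans : y ∈I[ u , v ] → w ∈I[ u , y ] → w ∈I[ u , v ]
  I-trans (k , P , P-sh , y∈P) (i′ , Q′ , Q′-sh , w∈Q′) with split-at y∈P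
  ... | split {i} {j} Q R i+j≡k = i′ + j , Q′ ++ʷ R , Q′R-sh , ∈-++ʷˡ R w∈Q′
    where
    i′≡i : i′ ≡ i
    i′≡i = ≤-antisym (Q′-sh i Q) (prefix-shortest P P-sh (split Q R i+j≡k) i′ Q′)
    Q′R-sh : Shortest G (Q′ ++ʷ R)
    Q′R-sh k′ T = subst (_≤ k′) (trans (sym i+j≡k) (cong (_+ j) (sym i′≡i))) (P-sh k′ T)

  I-from-start : {P : Walk G u v k} → Shortest G P → OnWalk G y P → OnWalk G z P →
                 y ∈I[ u , z ] ⊎ z ∈I[ u , y ]
  I-from-start {P = P} P-sh y∈P z∈P = Data.Sum.map interval interval (prefix-through y∈P z∈P)
    where
    interval : PrefixThrough P x w → x ∈I[ _ , w ]
    interval (s , x∈Q) = _ , prefix s , prefix-shortest P P-sh s , x∈Q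

  betweenness : {P : Walk G u v k} → Shortest G P → OnWalk G x P → OnWalk G y P → OnWalk G z P →
                x ∈I[ y , z ] ⊎ y ∈I[ x , z ] ⊎ z ∈I[ x , y ]
  betweenness P-sh here y∈P z∈P = inj₂ (I-from-start P-sh y∈P z∈P)
  betweenness P-sh (there x∈P) here z∈P =
    [ inj₁ , (λ z∈I → inj₂ (inj₂ (I-sym z∈I))) ]′ (I-from-start P-sh (there x∈P) z∈P)
  betweenness {P = P} P-sh (there x∈P) (there y∈P) here =
    [ (λ x∈I → inj₁ (I-sym x∈I)) , (λ y∈I → inj₂ (inj₁ (I-sym y∈I))) ]′
      (I-from-start {P = P} P-sh (there x∈P) (there y∈P))
  betweenness {P = cons e P} P-sh (there x∈P) (there y∈P) (there z∈P) =
    betweenness (tail-shortest e P P-sh) x∈P y∈P z∈P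

  adjacent⇒distinct : adj u v ≡ true → u ≢ v
  adjacent⇒distinct {u} u~u refl with () ← trans (sym u~u) (Graph.irrefl G u)

  P₃-interval : InducedP₃ adj u y v → y ∈I[ u , v ]
  P₃-interval {u} {y} {v} (induced u~y y~v u≁v u≢v) = 2 , cons u~y (cons y~v nil) , shortest , there here
    where
    shortest : Shortest G (cons u~y (cons y~v nil))
    shortest zero          nil            = ⊥-elim (u≢v refl)
    shortest (suc zero)    (cons u~v nil) with () ← trans (sym u~v) u≁v
    shortest (suc (suc k)) _              = s≤s (s≤s z≤n)

  gp-interval : ∀ {S} → GenPos G S → u ∈ S → v ∈ S → w ∈ S → u ≢ v → w ≢ u → w ≢ v → ¬ w ∈I[ u , v ]
  gp-interval S-gp u∈S v∈S w∈S u≢v w≢u w≢v (k , P , P-sh , w∈P) =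
    S-gp _ _ k P P-sh (_ , _ , _ , u≢v , w≢u ∘ sym , w≢v ∘ sym , u∈S , v∈S , w∈S , here , end∈ P , w∈P)

  gp⇒P₃-free : ∀ {S} → GenPos G S → P₃-Free adj (_∈ S)
  gp⇒P₃-free S-gp u∈S m∈S v∈S p@(induced u~m m~v _ u≢v) =
    gp-interval S-gp u∈S v∈S m∈S u≢v (adjacent⇒distinct u~m ∘ sym) (adjacent⇒distinct m~v)
                (P₃-interval p)

  I-refl : w ∈I[ w , w ]
  I-refl = 0 , nil , (λ _ _ → z≤n) , here

  covered⇒geodetic : ∀ {S} → (∀ w → Covered adj (_∈ S) w) → Geodetic G S
  covered⇒geodetic S-covers w with S-covers w
  ... | inj₁ w∈S                    = w , w , w∈S , w∈S , I-refl
  ... | inj₂ (u , v , u∈S , v∈S , p) = u , v , u∈S , v∈S , P₃-interval p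

  geodesic₂⇒P₃ : (u~w : adj u w ≡ true) (w~v : adj w v ≡ true) →
                 Shortest G (cons u~w (cons w~v nil)) → InducedP₃ adj u w v
  geodesic₂⇒P₃ {u} {v = v} u~w w~v P-sh = induced u~w w~v u≁v u≢v
    where
    u≁v : adj u v ≡ false
    u≁v with adj u v in u~v
    ... | true  with s≤s () ← P-sh 1 (cons u~v nil)
    ... | false = refl
    u≢v : u ≢ v
    u≢v refl with () ← P-sh 0 nil

-- Graphs of diameter at most two

Diameter≤2 : {A : Set} → (A → A → Bool) → Set
Diameter≤2 adj = ∀ u v → u ≡ v ⊎ adj u v ≡ true ⊎ Σ _ λ w → adj u w ≡ true × adj w v ≡ true

module DiameterTwo (G : Graph) (diameter≤2 : Diameter≤2 (Graph.adj G)) where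
  open Graph G using (n; adj)
  open Geodesics G

  private variable
    S : Subset n
    u v w : Fin n
    k : ℕ

  short-walk : ∀ u v → Σ ℕ λ k → k ≤ 2 × Walk G u v k
  short-walk u v with diameter≤2 u v
  ... | inj₁ refl                   = 0 , z≤n , nil
  ... | inj₂ (inj₁ u~v)             = 1 , s≤s z≤n , cons u~v nil
  ... | inj₂ (inj₂ (w , u~w , w~v)) = 2 , s≤s (s≤s z≤n) , cons u~w (cons w~v nil)

  connected : Connected G
  connected u v with short-walk u v
  ... | k , _ , W = k , W

  shortest≤2 : (P : Walk G u v k) → Shortest G P → k ≤ 2
  shortest≤2 {u} {v} P P-sh with short-walk u v
  ... | _ , k≤2 , W = ≤-trans (P-sh _ W) k≤2

  I-characterisation : w ∈I[ u , v ] → w ≡ u ⊎ w ≡ v ⊎ InducedP₃ adj u w v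
  I-characterisation (k , P , P-sh , w∈P) = on-geodesic P (shortest≤2 P P-sh) P-sh w∈P
    where
    on-geodesic : (P : Walk G u v k) → k ≤ 2 → Shortest G P → OnWalk G w P →
                  w ≡ u ⊎ w ≡ v ⊎ InducedP₃ adj u w v
    on-geodesic _                            _              _    here                 = inj₁ refl
    on-geodesic (cons _ nil)                 _              _    (there here)         = inj₂ (inj₁ refl)
    on-geodesic (cons _ (cons _ nil))        _              _    (there (there here)) = inj₂ (inj₁ refl)
    on-geodesic (cons u~w (cons w~v nil))    _              P-sh (there here)         =
      inj₂ (inj₂ (geodesic₂⇒P₃ u~w w~v P-sh))
    on-geodesic (cons _ (cons _ (cons _ _))) (s≤s (s≤s ())) _    _

  P₃-free⇒gp : P₃-Free adj (_∈ S) → GenPos G S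
  P₃-free⇒gp {S} S-free _ _ _ P P-sh (x , y , z , x≢y , x≢z , y≢z , x∈S , y∈S , z∈S , x∈P , y∈P , z∈P)
    = [ strictly-inside y∈S x∈S z∈S x≢y x≢z
      , [ strictly-inside x∈S y∈S z∈S (x≢y ∘ sym) y≢z
        , strictly-inside x∈S z∈S y∈S (x≢z ∘ sym) (y≢z ∘ sym) ]′ ]′
      (betweenness P-sh x∈P y∈P z∈P)
    where
    strictly-inside : u ∈ S → w ∈ S → v ∈ S → w ≢ u → w ≢ v → ¬ w ∈I[ u , v ]
    strictly-inside u∈S w∈S v∈S w≢u w≢v w∈I with I-characterisation w∈I
    ... | inj₁ w≡u        = w≢u w≡u
    ... | inj₂ (inj₁ w≡v) = w≢v w≡v
    ... | inj₂ (inj₂ p)   = S-free u∈S w∈S v∈S p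

  geodetic⇒covered : Geodetic G S → ∀ w → Covered adj (_∈ S) w
  geodetic⇒covered S-geo w with S-geo w
  ... | u , v , u∈S , v∈S , w∈I with I-characterisation w∈I
  ... | inj₁ refl        = inj₁ u∈S
  ... | inj₂ (inj₁ refl) = inj₁ v∈S
  ... | inj₂ (inj₂ p)    = inj₂ (u , v , u∈S , v∈S , p)

-- Small geodetic numbers force gp⁻ ≤ g

module SmallGeodeticNumber (G : Graph) where
  open Graph G using (n)
  open Geodesics G

  private variable
    S : Subset n
    w x y z : Fin n

  geodetic∧gp⇒maximal : Geodetic G S → GenPos G S → MaximalGenPos G S
  geodetic∧gp⇒maximal {S} S-geo S-gp = S-gp , maximal
    where
    maximal : ∀ T → S ⊆ T → GenPos G T → T ⊆ S
    maximal T S⊆T T-gp {x} x∈T with S-geo x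
    ... | s , t , s∈S , t∈S , x∈I with x ≟ s | x ≟ t
    ... | yes refl | _        = s∈S
    ... | no _     | yes refl = t∈S
    ... | no x≢s   | no x≢t   = ⊥-elim (gp-interval T-gp (S⊆T s∈S) (S⊆T t∈S) x∈T s≢t x≢s x≢t x∈I)
      where
      s≢t : s ≢ t
      s≢t refl = x≢s (I-self x∈I)

  distinct₃ : x ≢ y → x ≢ z → y ≢ z → Unique (x ∷ y ∷ z ∷ [])
  distinct₃ x≢y x≢z y≢z = (x≢y ∷ x≢z ∷ []) ∷ (y≢z ∷ []) ∷ [] ∷ []

  members₃ : x ∈ S → y ∈ S → z ∈ S → ∀ {v} → v ∈ₗ x ∷ y ∷ z ∷ [] → v ∈ S
  members₃ x∈S _   _   (here refl)                 = x∈S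
  members₃ _   y∈S _   (there (here refl))         = y∈S
  members₃ _   _   z∈S (there (there (here refl))) = z∈S

  ∣S∣≤2⇒gp : ∣ S ∣ ≤ 2 → GenPos G S
  ∣S∣≤2⇒gp ∣S∣≤2 _ _ _ _ _ (_ , _ , _ , x≢y , x≢z , y≢z , x∈S , y∈S , z∈S , _) =
    <⇒≱ (length≤∣p∣ (distinct₃ x≢y x≢z y≢z) (members₃ x∈S y∈S z∈S)) ∣S∣≤2

  OneOf₃ : Fin n → Fin n → Fin n → Fin n → Set
  OneOf₃ x y z s = s ≡ x ⊎ s ≡ y ⊎ s ≡ z

  I-within : y ∈I[ x , z ] → ∀ {s t} → OneOf₃ x y z s → OneOf₃ x y z t → w ∈I[ s , t ] → w ∈I[ x , z ]
  I-within y∈I (inj₁ refl)        (inj₁ refl)        w∈I with refl ← I-self w∈I = I-start y∈I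
  I-within y∈I (inj₁ refl)        (inj₂ (inj₁ refl)) w∈I = I-trans y∈I w∈I
  I-within y∈I (inj₁ refl)        (inj₂ (inj₂ refl)) w∈I = w∈I
  I-within y∈I (inj₂ (inj₁ refl)) (inj₁ refl)        w∈I = I-trans y∈I (I-sym w∈I)
  I-within y∈I (inj₂ (inj₁ refl)) (inj₂ (inj₁ refl)) w∈I with refl ← I-self w∈I = y∈I
  I-within y∈I (inj₂ (inj₁ refl)) (inj₂ (inj₂ refl)) w∈I = I-sym (I-trans (I-sym y∈I) (I-sym w∈I))
  I-within y∈I (inj₂ (inj₂ refl)) (inj₁ refl)        w∈I = I-sym w∈I
  I-within y∈I (inj₂ (inj₂ refl)) (inj₂ (inj₁ refl)) w∈I = I-sym (I-trans (I-sym y∈I) w∈I)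
  I-within y∈I (inj₂ (inj₂ refl)) (inj₂ (inj₂ refl)) w∈I with refl ← I-self w∈I = I-end y∈I

  geodetic-contract : y ∈I[ x , z ] → (∀ {s} → s ∈ S → OneOf₃ x y z s) → Geodetic G S →
                      Geodetic G (fromList (x ∷ z ∷ []))
  geodetic-contract {x = x} {z = z} y∈I S⊆xyz S-geo w with S-geo w
  ... | s , t , s∈S , t∈S , w∈I =
    x , z , ∈-fromList⁺ {xs = x ∷ z ∷ []} (here refl) , ∈-fromList⁺ {xs = x ∷ z ∷ []} (there (here refl)) ,
    I-within y∈I (S⊆xyz s∈S) (S⊆xyz t∈S) w∈I

  geodetic₃⇒gp : Geodetic G S → ∣ S ∣ ≡ 3 → (∀ T → Geodetic G T → 3 ≤ ∣ T ∣) → GenPos G S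
  geodetic₃⇒gp {S} S-geo ∣S∣≡3 g≥3 _ _ _ P P-sh
    (x , y , z , x≢y , x≢z , y≢z , x∈S , y∈S , z∈S , x∈P , y∈P , z∈P)
    -- one case per vertex in the middle, with S ⊆ {x, y, z} reordered to put that vertex second
    = [ contract ([ inj₂ ∘ inj₁ , Data.Sum.map₂ inj₂ ]′ ∘ S⊆xyz)
      , [ contract S⊆xyz , contract (Data.Sum.map₂ Data.Sum.swap ∘ S⊆xyz) ]′ ]′
      (betweenness P-sh x∈P y∈P z∈P)
    where
    contract : ∀ {u m v} → (∀ {s} → s ∈ S → OneOf₃ u m v s) → ¬ m ∈I[ u , v ]
    contract {u} {v = v} S⊆umv m∈I =
      <⇒≱ (g≥3 _ (geodetic-contract m∈I S⊆umv S-geo)) (∣fromList∣≤length (u ∷ v ∷ []))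
    S⊆xyz : ∀ {s} → s ∈ S → OneOf₃ x y z s
    S⊆xyz s∈S with ∣p∣≤length⇒⊆ (distinct₃ x≢y x≢z y≢z) (members₃ x∈S y∈S z∈S) (≤-reflexive ∣S∣≡3) s∈S
    ... | here s≡x                 = inj₁ s≡x
    ... | there (here s≡y)         = inj₂ (inj₁ s≡y)
    ... | there (there (here s≡z)) = inj₂ (inj₂ s≡z)

  gp⁻≤g : ∀ {a b} → GpMinus G a → GeodeticNumber G b → b ≤ 3 → a ≤ b
  gp⁻≤g {a} {b} (_ , a≤maximal) ((S , S-geo , ∣S∣≡b) , b≤geodetic) b≤3 =
    subst (a ≤_) ∣S∣≡b (a≤maximal S (geodetic∧gp⇒maximal S-geo S-gp))
    where
    S-gp : GenPos G S
    S-gp with m≤n⇒m<n∨m≡n b≤3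
    ... | inj₁ b<3  = ∣S∣≤2⇒gp (subst (_≤ 2) (sym ∣S∣≡b) (≤-pred b<3))
    ... | inj₂ refl = geodetic₃⇒gp S-geo ∣S∣≡b b≤geodetic

module Presented {V : Set} {N : ℕ} (ι : Fin N ↔ V) (adjV : V → V → Bool)
                 (adjV-sym : ∀ x y → adjV x y ≡ adjV y x) (adjV-irrefl : ∀ x → adjV x x ≡ false)
                 (diameter≤2 : Diameter≤2 adjV) where
  open Inverse ι using (to; from; strictlyInverseˡ; strictlyInverseʳ)

  G : Graph
  G = record { n = N ; adj = λ u v → adjV (to u) (to v) ; sym = λ u v → adjV-sym (to u) (to v)
             ; irrefl = adjV-irrefl ∘ to }

  open Graph G using (adj)

  -- A record rather than a synonym for from v ∈ S, so that v is inferable from a membership proof.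
  infix 4 _∈ᵛ_
  record _∈ᵛ_ (v : V) (S : Subset N) : Set where
    constructor lift∈
    field lower∈ : from v ∈ S
  open _∈ᵛ_ public

  _∈ᵛ?_ : ∀ v S → Dec (v ∈ᵛ S)
  v ∈ᵛ? S = map′ lift∈ lower∈ (from v ∈? S)

  private variable
    S : Subset N
    w : V
    ys : List V

  to-embedding : Embedding adj adjV to
  to-embedding = record
    { adj-preserving = λ _ _ → refl
    ; injective      = λ {u} {v} tu≡tv →
        trans (sym (strictlyInverseʳ u)) (trans (cong from tu≡tv) (strictlyInverseʳ v))
    }

  from-embedding : Embedding adjV adj from
  from-embedding = record
    { adj-preserving = λ x y → cong₂ adjV (strictlyInverseˡ x) (strictlyInverseˡ y)
    ; injective      = λ {x} {y} fx≡fy →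
        trans (sym (strictlyInverseˡ x)) (trans (cong to fx≡fy) (strictlyInverseˡ y))
    }

  ∈ᵛ-to : ∀ {u} → u ∈ S → to u ∈ᵛ S
  ∈ᵛ-to {S} {u} = lift∈ ∘ subst (_∈ S) (sym (strictlyInverseʳ u))

  adj-diameter≤2 : Diameter≤2 adj
  adj-diameter≤2 u v with diameter≤2 (to u) (to v)
  ... | inj₁ tu≡tv                  = inj₁ (Embedding.injective to-embedding tu≡tv)
  ... | inj₂ (inj₁ u~v)             = inj₂ (inj₁ u~v)
  ... | inj₂ (inj₂ (c , u~c , c~v)) =
    inj₂ (inj₂ (from c , subst (λ c′ → adjV (to u) c′ ≡ true) (sym (strictlyInverseˡ c)) u~c
                       , subst (λ c′ → adjV c′ (to v) ≡ true) (sym (strictlyInverseˡ c)) c~v))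

  private
    module D = DiameterTwo G adj-diameter≤2

  open D public using (connected)

  gp⇒P₃-free : GenPos G S → P₃-Free adjV (_∈ᵛ S)
  gp⇒P₃-free = P₃-Free-mono lower∈ ∘ P₃-Free-pullback from-embedding ∘ Geodesics.gp⇒P₃-free G

  maximal⇒P₃-free : MaximalGenPos G S → P₃-Free adjV (_∈ᵛ S)
  maximal⇒P₃-free = gp⇒P₃-free ∘ proj₁

  P₃-free⇒gp : P₃-Free adjV (_∈ᵛ S) → GenPos G S
  P₃-free⇒gp = D.P₃-free⇒gp ∘ P₃-Free-mono ∈ᵛ-to ∘ P₃-Free-pullback to-embedding

  geodetic⇒covered : Geodetic G S → ∀ v → Covered adjV (_∈ᵛ S) v
  geodetic⇒covered {S} S-geo v =
    subst (Covered adjV (_∈ᵛ S)) (strictlyInverseˡ v)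
          (Covered-push to-embedding (Covered-mono ∈ᵛ-to (D.geodetic⇒covered S-geo (from v))))

  covered⇒geodetic : (∀ v → Covered adjV (_∈ᵛ S) v) → Geodetic G S
  covered⇒geodetic {S} S-covers = Geodesics.covered⇒geodetic G λ u →
    subst (Covered adj (_∈ S)) (strictlyInverseʳ u)
          (Covered-push from-embedding (Covered-mono lower∈ (S-covers (to u))))

  maximal-contains : MaximalGenPos G S →
                     (∀ {x y} → x ∈ᵛ S → y ∈ᵛ S → ¬ InducedP₃ adjV x w y) →
                     (∀ {m y} → m ∈ᵛ S → y ∈ᵛ S → ¬ InducedP₃ adjV w m y) →
                     w ∈ᵛ S
  maximal-contains {S} {w} (S-gp , S-maximal) not-middle not-end =
    lift∈ (S-maximal (S ∪ ⁅ from w ⁆) (p⊆p∪q _) (P₃-free⇒gp extended) (x∈p∪q⁺ (inj₂ (x∈⁅x⁆ (from w)))))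
    where
    ∪-split : ∀ {x} → x ∈ᵛ S ∪ ⁅ from w ⁆ → x ∈ᵛ S ⊎ x ≡ w
    ∪-split = Data.Sum.map lift∈ (Embedding.injective from-embedding ∘ x∈⁅y⁆⇒x≡y _) ∘ x∈p∪q⁻ S _ ∘ lower∈
    extended : P₃-Free adjV (_∈ᵛ S ∪ ⁅ from w ⁆)
    extended = P₃-Free-mono ∪-split
                 (P₃-extend adjV-irrefl adjV-sym (gp⇒P₃-free S-gp) not-middle not-end)

  blocked⇒maximal : P₃-Free adjV (_∈ᵛ S) →
                    (∀ v → v ∈ᵛ S ⊎ Σ V λ m → Σ V λ y → m ∈ᵛ S × y ∈ᵛ S × InducedP₃ adjV v m y) →
                    MaximalGenPos G S
  blocked⇒maximal {S} S-free blocked = P₃-free⇒gp S-free , maximal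
    where
    maximal : ∀ T → S ⊆ T → GenPos G T → T ⊆ S
    maximal T S⊆T T-gp {u} u∈T with blocked (to u)
    ... | inj₁ tu∈S                  = subst (_∈ S) (strictlyInverseʳ u) (lower∈ tu∈S)
    ... | inj₂ (m , y , m∈S , y∈S , p) =
      ⊥-elim (gp⇒P₃-free T-gp (∈ᵛ-to u∈T) (lift∈ (S⊆T (lower∈ m∈S))) (lift∈ (S⊆T (lower∈ y∈S))) p)

  image : ∀ {k} → (Fin k → V) → Subset N
  image f = fromList (tabulate (from ∘ f))

  ∈-image⁺ : ∀ {k} (f : Fin k → V) i → f i ∈ᵛ image f
  ∈-image⁺ f i = lift∈ (∈-fromList⁺ (∈-tabulate⁺ i))

  ∈-image⁻ : ∀ {k} (f : Fin k → V) {w} → w ∈ᵛ image f → Σ (Fin k) λ i → w ≡ f i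
  ∈-image⁻ f w∈ with ∈-tabulate⁻ (∈-fromList⁻ (tabulate (from ∘ f)) (lower∈ w∈))
  ... | i , fw≡ffi = i , Embedding.injective from-embedding fw≡ffi

  ∣image∣≤ : ∀ {k} (f : Fin k → V) → ∣ image f ∣ ≤ k
  ∣image∣≤ f = ≤-trans (∣fromList∣≤length (tabulate (from ∘ f)))
                       (≤-reflexive (length-tabulate (from ∘ f)))

  length≤∣S∣ : Unique ys → (∀ {v} → v ∈ₗ ys → v ∈ᵛ S) → length ys ≤ ∣ S ∣
  length≤∣S∣ {ys} {S} ys-unique ys⊆S =
    subst (_≤ ∣ S ∣) (length-map from ys)
      (length≤∣p∣ (Unique.map⁺ (Embedding.injective from-embedding) ys-unique) mapped⊆S)
    where
    mapped⊆S : ∀ {u} → u ∈ₗ Data.List.map from ys → u ∈ S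
    mapped⊆S u∈ with ∈-map⁻ from u∈
    ... | _ , y∈ys , refl = lower∈ (ys⊆S y∈ys)

  family≤∣S∣ : ∀ {k} (f : Fin k → V) → (∀ {i j} → f i ≡ f j → i ≡ j) → (∀ i → f i ∈ᵛ S) → k ≤ ∣ S ∣
  family≤∣S∣ {S} f f-injective f⊆S =
    subst (_≤ ∣ S ∣) (length-tabulate f) (length≤∣S∣ (Unique.tabulate⁺ f-injective) tabulate⊆S)
    where
    tabulate⊆S : ∀ {v} → v ∈ₗ tabulate f → v ∈ᵛ S
    tabulate⊆S v∈ with ∈-tabulate⁻ v∈
    ... | i , refl = f⊆S i

module _ {n : ℕ} where

  _≢ᵇ_ : Fin n → Fin n → Bool
  i ≢ᵇ j = not (does (i ≟ j))

  ≢⇒≢ᵇ : ∀ {i j} → i ≢ j → (i ≢ᵇ j) ≡ true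
  ≢⇒≢ᵇ {i} {j} i≢j = cong not (dec-false (i ≟ j) i≢j)

  ≢ᵇ⇒≢ : ∀ {i j} → (i ≢ᵇ j) ≡ true → i ≢ j
  ≢ᵇ⇒≢ {i} i≢ᵇi refl with () ← trans (sym i≢ᵇi) (cong not (dec-true (i ≟ i) refl))

  ≢ᵇ-false⇒≡ : ∀ {i j} → (i ≢ᵇ j) ≡ false → i ≡ j
  ≢ᵇ-false⇒≡ {i} {j} i≡ᵇj with i ≟ j
  ... | yes i≡j = i≡j

  ≢ᵇ-irrefl : ∀ i → (i ≢ᵇ i) ≡ false
  ≢ᵇ-irrefl i = cong not (dec-true (i ≟ i) refl)

  ≢ᵇ-sym : ∀ i j → (i ≢ᵇ j) ≡ (j ≢ᵇ i)
  ≢ᵇ-sym i j with i ≟ j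
  ... | yes refl = sym (≢ᵇ-irrefl i)
  ... | no i≢j   = sym (≢⇒≢ᵇ (i≢j ∘ sym))

-- The complete split graph: a clique K_{q+1} joined to an independent set of l + 2 vertices

module CompleteSplit (q l : ℕ) (q≤l : q ≤ l) where

  V : Set
  V = Fin (suc q) ⊎ Fin (suc (suc l))

  pattern clique j = inj₁ j
  pattern indep i  = inj₂ i

  adjV : V → V → Bool
  adjV (clique i) (clique j) = i ≢ᵇ j
  adjV (clique _) (indep _)  = true
  adjV (indep _)  (clique _) = true
  adjV (indep _)  (indep _)  = false

  adjV-sym : ∀ x y → adjV x y ≡ adjV y x
  adjV-sym (clique i) (clique j) = ≢ᵇ-sym i j
  adjV-sym (clique _) (indep _)  = refl
  adjV-sym (indep _)  (clique _) = refl
  adjV-sym (indep _)  (indep _)  = refl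

  adjV-irrefl : ∀ x → adjV x x ≡ false
  adjV-irrefl (clique i) = ≢ᵇ-irrefl i
  adjV-irrefl (indep _)  = refl

  diameter≤2 : Diameter≤2 adjV
  diameter≤2 (clique i) (clique j) with i ≟ j
  ... | yes refl = inj₁ refl
  ... | no _     = inj₂ (inj₁ refl)
  diameter≤2 (clique _) (indep _)  = inj₂ (inj₁ refl)
  diameter≤2 (indep _)  (clique _) = inj₂ (inj₁ refl)
  diameter≤2 (indep i)  (indep j) with i ≟ j
  ... | yes refl = inj₁ refl
  ... | no _     = inj₂ (inj₂ (clique zero , refl , refl))

  open Presented +↔⊎ adjV adjV-sym adjV-irrefl diameter≤2

  data Shape : V → V → V → Set where
    through-clique : ∀ i j k → Shape (indep i) (clique j) (indep k)

  shape : ∀ {x y z} → InducedP₃ adjV x y z → Shape x y z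
  shape {clique _} {_}        {clique _} (induced _ _ i≡ᵇk i≢k) =
    ⊥-elim (i≢k (cong clique (≢ᵇ-false⇒≡ i≡ᵇk)))
  shape {clique _} {_}        {indep _}  (induced _ _ () _)
  shape {indep _}  {_}        {clique _} (induced _ _ () _)
  shape {indep _}  {indep _}  {_}        (induced () _ _ _)
  shape {indep i}  {clique j} {indep k}  _ = through-clique i j k

  private variable
    S : Subset (suc q + suc (suc l))

  some-indep∈maximal : MaximalGenPos G S → Σ _ λ i → indep i ∈ᵛ S
  some-indep∈maximal {S} S-max with any? (λ i → indep i ∈ᵛ? S)
  ... | yes found  = found
  ... | no ¬found = ⊥-elim (¬found (zero , maximal-contains S-max not-middle not-end))
    where
    not-middle : ∀ {x y} → x ∈ᵛ S → y ∈ᵛ S → ¬ InducedP₃ adjV x (indep zero) y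
    not-middle _ _ p with () ← shape p
    not-end : ∀ {m y} → m ∈ᵛ S → y ∈ᵛ S → ¬ InducedP₃ adjV (indep zero) m y
    not-end _ y∈S p with shape p
    ... | through-clique _ _ k = ¬found (k , y∈S)

  clique⊆maximal : MaximalGenPos G S → ∀ {j₀} → clique j₀ ∈ᵛ S → ∀ j → clique j ∈ᵛ S
  clique⊆maximal {S} S-max {j₀} j₀∈S j = maximal-contains S-max not-middle not-end
    where
    not-middle : ∀ {x y} → x ∈ᵛ S → y ∈ᵛ S → ¬ InducedP₃ adjV x (clique j) y
    not-middle x∈S y∈S p with shape p
    ... | through-clique _ _ _ = maximal⇒P₃-free S-max x∈S j₀∈S y∈S
                                   (induced refl refl (InducedP₃.nonadjacent p) (InducedP₃.ends-distinct p))
    not-end : ∀ {m y} → m ∈ᵛ S → y ∈ᵛ S → ¬ InducedP₃ adjV (clique j) m y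
    not-end _ _ p with () ← shape p

  indep⊆maximal : MaximalGenPos G S → (∀ j → ¬ clique j ∈ᵛ S) → ∀ i → indep i ∈ᵛ S
  indep⊆maximal {S} S-max no-clique i = maximal-contains S-max not-middle not-end
    where
    not-middle : ∀ {x y} → x ∈ᵛ S → y ∈ᵛ S → ¬ InducedP₃ adjV x (indep i) y
    not-middle _ _ p with () ← shape p
    not-end : ∀ {m y} → m ∈ᵛ S → y ∈ᵛ S → ¬ InducedP₃ adjV (indep i) m y
    not-end m∈S _ p with shape p
    ... | through-clique _ j _ = no-clique j m∈S

  clique-and : Fin (suc (suc l)) → Fin (suc (suc q)) → V
  clique-and i zero    = indep i
  clique-and i (suc j) = clique j

  clique-and-injective : ∀ {i} {j j′} → clique-and i j ≡ clique-and i j′ → j ≡ j′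
  clique-and-injective {j = zero}  {zero}   _    = refl
  clique-and-injective {j = suc j} {suc j′} refl = refl

  gp⁻-lower-bound : ∀ S → MaximalGenPos G S → suc (suc q) ≤ ∣ S ∣
  gp⁻-lower-bound S S-max with any? (λ j → clique j ∈ᵛ? S) | some-indep∈maximal S-max
  ... | yes (j₀ , j₀∈S) | i₀ , i₀∈S = family≤∣S∣ (clique-and i₀) clique-and-injective members
    where
    members : ∀ j → clique-and i₀ j ∈ᵛ S
    members zero    = i₀∈S
    members (suc j) = clique⊆maximal S-max j₀∈S j
  ... | no ¬clique | _ =
    ≤-trans (s≤s (s≤s q≤l))
            (family≤∣S∣ indep inj₂-injective (indep⊆maximal S-max λ j j∈S → ¬clique (j , j∈S)))

  S₀ : Subset (suc q + suc (suc l))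
  S₀ = image (clique-and zero)

  indep∈S₀⇒zero : ∀ {i} → indep i ∈ᵛ S₀ → i ≡ zero
  indep∈S₀⇒zero {i} i∈S₀ with ∈-image⁻ (clique-and zero) {indep i} i∈S₀
  ... | zero , refl = refl

  S₀-maximal : MaximalGenPos G S₀
  S₀-maximal = blocked⇒maximal S₀-free blocked
    where
    S₀-free : P₃-Free adjV (_∈ᵛ S₀)
    S₀-free x∈S₀ _ z∈S₀ p with shape p
    ... | through-clique i _ k = InducedP₃.ends-distinct p
                                   (cong indep (trans (indep∈S₀⇒zero {i} x∈S₀) (sym (indep∈S₀⇒zero {k} z∈S₀))))
    blocked : ∀ v → v ∈ᵛ S₀ ⊎ Σ V λ m → Σ V λ y → m ∈ᵛ S₀ × y ∈ᵛ S₀ × InducedP₃ adjV v m y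
    blocked (clique j)      = inj₁ (∈-image⁺ (clique-and zero) (suc j))
    blocked (indep zero)    = inj₁ (∈-image⁺ (clique-and zero) zero)
    blocked (indep (suc i)) = inj₂ (clique zero , indep zero , ∈-image⁺ (clique-and zero) (suc zero) ,
                                    ∈-image⁺ (clique-and zero) zero , induced refl refl refl λ ())

  gp⁻ : GpMinus G (suc (suc q))
  gp⁻ = (S₀ , S₀-maximal , ≤-antisym (∣image∣≤ (clique-and zero)) (gp⁻-lower-bound S₀ S₀-maximal)) ,
        gp⁻-lower-bound

  indep⊆geodetic : Geodetic G S → ∀ i → indep i ∈ᵛ S
  indep⊆geodetic S-geo i with geodetic⇒covered S-geo (indep i)
  ... | inj₁ i∈S                = i∈S
  ... | inj₂ (_ , _ , _ , _ , p) with () ← shape p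

  indep-geodetic : Geodetic G (image indep)
  indep-geodetic = covered⇒geodetic covers
    where
    covers : ∀ v → Covered adjV (_∈ᵛ image indep) v
    covers (indep i)  = inj₁ (∈-image⁺ indep i)
    covers (clique _) = inj₂ (_ , _ , ∈-image⁺ indep 0F , ∈-image⁺ indep 1F , induced refl refl refl λ ())

  g : GeodeticNumber G (suc (suc l))
  g = (image indep , indep-geodetic , ≤-antisym (∣image∣≤ indep) (lower-bound indep-geodetic)) ,
      λ _ → lower-bound
    where
    lower-bound : Geodetic G S → suc (suc l) ≤ ∣ S ∣
    lower-bound S-geo = family≤∣S∣ indep inj₂-injective (indep⊆geodetic S-geo)

  realization : Realizes (suc (suc q)) (suc (suc l))
  realization = G , connected , gp⁻ , g

-- A complete (s+4)-partite graph with parts of size s + 5, and r outer vertices adjacent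
-- exactly to the first vertex (the hub) of every part

module HubbedMultipartite (r s : ℕ) where

  k : ℕ
  k = 4 + s

  V : Set
  V = Fin r ⊎ (Fin k × Fin (suc k))

  pattern outer i   = inj₁ i
  pattern ⟨_,_⟩ p j = inj₂ (p , j)

  is-hub : Fin (suc k) → Bool
  is-hub zero    = true
  is-hub (suc _) = false

  adjV : V → V → Bool
  adjV (outer _)   (outer _)    = false
  adjV (outer _)   ⟨ _ , j ⟩    = is-hub j
  adjV ⟨ _ , j ⟩   (outer _)    = is-hub j
  adjV ⟨ p , _ ⟩   ⟨ p′ , _ ⟩   = p ≢ᵇ p′

  adjV-sym : ∀ x y → adjV x y ≡ adjV y x
  adjV-sym (outer _)   (outer _)    = refl
  adjV-sym (outer _)   ⟨ _ , _ ⟩    = refl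
  adjV-sym ⟨ _ , _ ⟩   (outer _)    = refl
  adjV-sym ⟨ p , _ ⟩   ⟨ p′ , _ ⟩   = ≢ᵇ-sym p p′

  adjV-irrefl : ∀ x → adjV x x ≡ false
  adjV-irrefl (outer _)   = refl
  adjV-irrefl ⟨ p , _ ⟩   = ≢ᵇ-irrefl p

  other : Fin k → Fin k
  other 0F      = 1F
  other (suc _) = 0F

  other≢ : ∀ p → other p ≢ p
  other≢ 0F      ()
  other≢ (suc _) ()

  other~ : ∀ p → (p ≢ᵇ other p) ≡ true
  other~ p = ≢⇒≢ᵇ (other≢ p ∘ sym)

  ~other : ∀ p → (other p ≢ᵇ p) ≡ true
  ~other p = ≢⇒≢ᵇ (other≢ p)

  diameter≤2 : Diameter≤2 adjV
  diameter≤2 (outer i) (outer i′) with i ≟ i′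
  ... | yes refl = inj₁ refl
  ... | no _     = inj₂ (inj₂ (⟨ 0F , 0F ⟩ , refl , refl))
  diameter≤2 (outer _)   ⟨ _ , 0F ⟩    = inj₂ (inj₁ refl)
  diameter≤2 (outer _)   ⟨ p , suc _ ⟩ = inj₂ (inj₂ (⟨ other p , 0F ⟩ , refl , ~other p))
  diameter≤2 ⟨ _ , 0F ⟩    (outer _)   = inj₂ (inj₁ refl)
  diameter≤2 ⟨ p , suc _ ⟩ (outer _)   = inj₂ (inj₂ (⟨ other p , 0F ⟩ , other~ p , refl))
  diameter≤2 ⟨ p , j ⟩ ⟨ p′ , j′ ⟩ with p ≟ p′ | j ≟ j′
  ... | no _     | _        = inj₂ (inj₁ refl)
  ... | yes refl | yes refl = inj₁ refl
  ... | yes refl | no _     = inj₂ (inj₂ (⟨ other p , 0F ⟩ , other~ p , ~other p))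

  -- Opaque: unfolding the arithmetic of r + k * suc k makes type checking intractable.
  opaque
    ι : Fin (r + k * suc k) ↔ V
    ι = ↔-trans +↔⊎ (↔-refl ⊎-↔ *↔×)

  open Presented ι adjV adjV-sym adjV-irrefl diameter≤2

  private variable
    S : Subset (r + k * suc k)

  Pair : Subset (r + k * suc k) → Fin k → Set
  Pair S p = Σ _ λ j → Σ _ λ j′ → j ≢ j′ × ⟨ p , j ⟩ ∈ᵛ S × ⟨ p , j′ ⟩ ∈ᵛ S

  pair? : ∀ S p → Dec (Pair S p)
  pair? S p = any? λ j → any? λ j′ → ¬? (j ≟ j′) ×-dec (⟨ p , j ⟩ ∈ᵛ? S) ×-dec (⟨ p , j′ ⟩ ∈ᵛ? S)

  pair-of : ∀ {p p′ j j′} → ⟨ p , j ⟩ ∈ᵛ S → ⟨ p′ , j′ ⟩ ∈ᵛ S → adjV ⟨ p , j ⟩ ⟨ p′ , j′ ⟩ ≡ false →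
            _≢_ {A = V} ⟨ p , j ⟩ ⟨ p′ , j′ ⟩ → Pair S p
  pair-of {p = p} {p′} {j} {j′} x∈S y∈S x≁y x≢y with refl ← ≢ᵇ-false⇒≡ {i = p} {p′} x≁y =
    j , j′ , (λ j≡j′ → x≢y (cong (λ j → ⟨ p , j ⟩) j≡j′)) , x∈S , y∈S

  -- Such a non-hub has no neighbour in S: it would be the middle of an induced P₃ joining the pair.
  pair⇒nonhubs⊆maximal : MaximalGenPos G S → ∀ {p} → Pair S p → ∀ w → ⟨ p , suc w ⟩ ∈ᵛ S
  pair⇒nonhubs⊆maximal {S} S-max {p} (j , j′ , j≢j′ , j∈S , j′∈S) w =
    maximal-contains S-max (λ x∈S _ p₃ → isolated x∈S (InducedP₃.adjˡ p₃))
                           (λ {m} m∈S _ p₃ → isolated m∈S (trans (adjV-sym m ⟨ p , suc w ⟩) (InducedP₃.adjˡ p₃)))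
    where
    isolated : ∀ {y} → y ∈ᵛ S → ¬ adjV y ⟨ p , suc w ⟩ ≡ true
    isolated {outer _}      _   ()
    isolated {⟨ p′ , _ ⟩} y∈S y~ = maximal⇒P₃-free S-max j∈S y∈S j′∈S
      (induced (trans (≢ᵇ-sym p p′) y~) y~ (≢ᵇ-irrefl p) (j≢j′ ∘ ,-injectiveʳ ∘ inj₂-injective))

  module EmptyPart {S} (S-max : MaximalGenPos G S) (no-pair : ∀ p → ¬ Pair S p)
                   {p} (empty : ∀ j → ¬ ⟨ p , j ⟩ ∈ᵛ S) where

    outside-part : ∀ {w p′ j′} → ⟨ p′ , j′ ⟩ ∈ᵛ S → ¬ adjV ⟨ p , w ⟩ ⟨ p′ , j′ ⟩ ≡ false
    outside-part {p′ = p′} {j′} y∈S p≡ᵇp′ with refl ← ≢ᵇ-false⇒≡ {i = p} {p′} p≡ᵇp′ = empty j′ y∈S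

    inner-ends : ∀ {p₁ j₁ m p₂ j₂} → ⟨ p₁ , j₁ ⟩ ∈ᵛ S → ⟨ p₂ , j₂ ⟩ ∈ᵛ S →
                 ¬ InducedP₃ adjV ⟨ p₁ , j₁ ⟩ m ⟨ p₂ , j₂ ⟩
    inner-ends x∈S y∈S (induced _ _ x≁y x≢y) = no-pair _ (pair-of x∈S y∈S x≁y x≢y)

    module _ {p′} (hub∈S : ⟨ p′ , 0F ⟩ ∈ᵛ S) where

      outer-inner : ∀ {i p₂ j₂} → outer i ∈ᵛ S → ⟨ p₂ , j₂ ⟩ ∈ᵛ S → ¬ adjV (outer i) ⟨ p₂ , j₂ ⟩ ≡ false
      outer-inner {j₂ = 0F} _ _ ()
      outer-inner {p₂ = p₂} {suc j₂} i∈S y∈S _ with p₂ ≟ p′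
      ... | yes refl = no-pair p₂ (0F , suc j₂ , (λ ()) , hub∈S , y∈S)
      ... | no p₂≢p′ = maximal⇒P₃-free S-max y∈S hub∈S i∈S (induced (≢⇒≢ᵇ p₂≢p′) refl refl λ ())

      hub∈maximal : ⟨ p , 0F ⟩ ∈ᵛ S
      hub∈maximal = maximal-contains S-max not-middle not-end
        where
        not-middle : ∀ {x y} → x ∈ᵛ S → y ∈ᵛ S → ¬ InducedP₃ adjV x ⟨ p , 0F ⟩ y
        not-middle {outer _}   {outer _}   x∈S y∈S (induced _ _ x≁y x≢y) =
          maximal⇒P₃-free S-max x∈S hub∈S y∈S (induced refl refl x≁y x≢y)
        not-middle {outer _}   {⟨ _ , _ ⟩} x∈S y∈S p₃ = outer-inner x∈S y∈S (InducedP₃.nonadjacent p₃)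
        not-middle {x@(⟨ _ , _ ⟩)} {y@(outer _)} x∈S y∈S p₃ =
          outer-inner y∈S x∈S (trans (adjV-sym y x) (InducedP₃.nonadjacent p₃))
        not-middle {⟨ _ , _ ⟩} {⟨ _ , _ ⟩} x∈S y∈S p₃ = inner-ends x∈S y∈S p₃
        not-end : ∀ {m y} → m ∈ᵛ S → y ∈ᵛ S → ¬ InducedP₃ adjV ⟨ p , 0F ⟩ m y
        not-end {y = outer _}   _ _   (induced _ _ () _)
        not-end {y = ⟨ _ , _ ⟩} _ y∈S p₃ = outside-part {w = 0F} y∈S (InducedP₃.nonadjacent p₃)

    nonhub∈maximal : (∀ p′ → ¬ ⟨ p′ , 0F ⟩ ∈ᵛ S) → ⟨ p , 1F ⟩ ∈ᵛ S
    nonhub∈maximal no-hub = maximal-contains S-max not-middle not-end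
      where
      not-middle : ∀ {x y} → x ∈ᵛ S → y ∈ᵛ S → ¬ InducedP₃ adjV x ⟨ p , 1F ⟩ y
      not-middle {outer _}                 _   _   (induced () _ _ _)
      not-middle {⟨ _ , _ ⟩} {outer _}     _   _   (induced _ () _ _)
      not-middle {⟨ _ , _ ⟩} {⟨ _ , _ ⟩} x∈S y∈S p₃ = inner-ends x∈S y∈S p₃
      not-end : ∀ {m y} → m ∈ᵛ S → y ∈ᵛ S → ¬ InducedP₃ adjV ⟨ p , 1F ⟩ m y
      not-end {outer _}                         _   _   (induced () _ _ _)
      not-end {⟨ p′ , 0F ⟩}                    m∈S _   _  = no-hub p′ m∈S
      not-end {⟨ _ , suc _ ⟩} {outer _}         _   _   (induced _ () _ _)
      not-end {⟨ _ , suc _ ⟩} {⟨ _ , _ ⟩}     _   y∈S p₃ = outside-part {w = 1F} y∈S (InducedP₃.nonadjacent p₃)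

  no-pair⇒occupied : MaximalGenPos G S → (∀ p → ¬ Pair S p) → ∀ p → Σ _ λ j → ⟨ p , j ⟩ ∈ᵛ S
  no-pair⇒occupied {S} S-max no-pair p with any? (λ j → ⟨ p , j ⟩ ∈ᵛ? S)
  ... | yes occupied = occupied
  ... | no ¬occupied with any? (λ p′ → ⟨ p′ , 0F ⟩ ∈ᵛ? S)
  ...   | yes (_ , hub∈S) = ⊥-elim (¬occupied (0F , EmptyPart.hub∈maximal S-max no-pair empty hub∈S))
    where empty = λ j j∈S → ¬occupied (j , j∈S)
  ...   | no ¬hub = ⊥-elim (¬occupied (1F , EmptyPart.nonhub∈maximal S-max no-pair empty no-hub))
    where
    empty = λ j j∈S → ¬occupied (j , j∈S)
    no-hub = λ p′ hub∈S → ¬hub (p′ , hub∈S)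

  gp⁻-lower-bound : ∀ S → MaximalGenPos G S → k ≤ ∣ S ∣
  gp⁻-lower-bound S S-max with any? (pair? S)
  ... | yes (p , pair) = family≤∣S∣ (λ w → ⟨ p , suc w ⟩) (suc-injective ∘ ,-injectiveʳ ∘ inj₂-injective)
                                    (pair⇒nonhubs⊆maximal S-max pair)
  ... | no ¬pair = family≤∣S∣ (λ p → ⟨ p , proj₁ (occupied p) ⟩) (,-injectiveˡ ∘ inj₂-injective)
                              (proj₂ ∘ occupied)
    where occupied = no-pair⇒occupied S-max λ p pair → ¬pair (p , pair)

  -- Part 0 is represented by its hub, so that every outer vertex ends an induced P₃ in the transversal.
  representative : Fin k → Fin (suc k)
  representative 0F      = 0F
  representative (suc _) = 1F

  transversal : Fin k → V
  transversal p = ⟨ p , representative p ⟩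

  transversal-maximal : MaximalGenPos G (image transversal)
  transversal-maximal = blocked⇒maximal T-free blocked
    where
    T-free : P₃-Free adjV (_∈ᵛ image transversal)
    T-free {x} {_} {z} x∈T _ z∈T (induced _ _ x≁z x≢z)
      with ∈-image⁻ transversal x∈T | ∈-image⁻ transversal z∈T
    ... | p , refl | p′ , refl with refl ← ≢ᵇ-false⇒≡ {i = p} {p′} x≁z = x≢z refl
    blocked : ∀ v → v ∈ᵛ image transversal ⊎
                    Σ V λ m → Σ V λ y → m ∈ᵛ image transversal × y ∈ᵛ image transversal × InducedP₃ adjV v m y
    blocked (outer _) = inj₂ (_ , _ , ∈-image⁺ transversal 0F , ∈-image⁺ transversal 1F , induced refl refl refl λ ())
    blocked ⟨ p , j ⟩ with j ≟ representative p
    ... | yes refl = inj₁ (∈-image⁺ transversal p)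
    ... | no j≢rep = inj₂ (_ , _ , ∈-image⁺ transversal (other p) , ∈-image⁺ transversal p ,
                           induced (other~ p) (~other p) (≢ᵇ-irrefl p) (j≢rep ∘ ,-injectiveʳ ∘ inj₂-injective))

  gp⁻ : GpMinus G k
  gp⁻ = (image transversal , transversal-maximal ,
         ≤-antisym (∣image∣≤ transversal) (gp⁻-lower-bound _ transversal-maximal)) , gp⁻-lower-bound

  -- The neighbours of an outer vertex are hubs, and distinct hubs are adjacent.
  outer⊆geodetic : Geodetic G S → ∀ i → outer i ∈ᵛ S
  outer⊆geodetic S-geo i with geodetic⇒covered S-geo (outer i)
  ... | inj₁ i∈S                 = i∈S
  ... | inj₂ (_ , _ , _ , _ , p₃) = ⊥-elim (not-middle p₃)
    where
    not-middle : ∀ {x y} → ¬ InducedP₃ adjV x (outer i) y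
    not-middle {outer _}                       (induced () _ _ _)
    not-middle {⟨ _ , suc _ ⟩}                 (induced () _ _ _)
    not-middle {⟨ _ , 0F ⟩} {outer _}          (induced _ () _ _)
    not-middle {⟨ _ , 0F ⟩} {⟨ _ , suc _ ⟩}    (induced _ () _ _)
    not-middle {⟨ p , 0F ⟩} {⟨ p′ , 0F ⟩}      (induced _ _ p≡ᵇp′ x≢y)
      with refl ← ≢ᵇ-false⇒≡ {i = p} {p′} p≡ᵇp′ = x≢y refl

  PairAway : Subset (r + k * suc k) → Fin k → Set
  PairAway S i = Σ _ λ p → p ≢ i × Pair S p

  pair-away? : ∀ S i → Dec (PairAway S i)
  pair-away? S i = any? λ p → ¬? (p ≟ i) ×-dec pair? S p

  -- A non-hub of part i is only ever the middle of an induced P₃ between two vertices of one other part.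
  nonhubs⊆geodetic : Geodetic G S → ∀ {i} → ¬ PairAway S i → ∀ j → ⟨ i , suc j ⟩ ∈ᵛ S
  nonhubs⊆geodetic {S} S-geo {i} ¬away j with geodetic⇒covered S-geo ⟨ i , suc j ⟩
  ... | inj₁ ∈S                          = ∈S
  ... | inj₂ (_ , _ , x∈S , y∈S , p₃) = ⊥-elim (not-middle x∈S y∈S p₃)
    where
    not-middle : ∀ {x y} → x ∈ᵛ S → y ∈ᵛ S → ¬ InducedP₃ adjV x ⟨ i , suc j ⟩ y
    not-middle {outer _}                 _   _   (induced () _ _ _)
    not-middle {⟨ _ , _ ⟩} {outer _}     _   _   (induced _ () _ _)
    not-middle {⟨ p , _ ⟩} {⟨ _ , _ ⟩} x∈S y∈S (induced p~i _ x≁y x≢y) =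
      ¬away (p , ≢ᵇ⇒≢ p~i , pair-of x∈S y∈S x≁y x≢y)

  inner+outer≤∣S∣ : (ys : List (Fin k × Fin (suc k))) → Unique ys → (∀ {y} → y ∈ₗ ys → inj₂ y ∈ᵛ S) →
                    (∀ i → outer i ∈ᵛ S) → length ys + r ≤ ∣ S ∣
  inner+outer≤∣S∣ {S} ys ys-unique ys⊆S outer⊆S = subst (_≤ ∣ S ∣) length-zs (length≤∣S∣ zs-unique zs⊆S)
    where
    zs : List V
    zs = Data.List.map inj₂ ys ++ tabulate outer
    disjoint : Disjoint (Data.List.map inj₂ ys) (tabulate outer)
    disjoint (v∈ys , v∈outer) with ∈-map⁻ inj₂ v∈ys | ∈-tabulate⁻ v∈outer
    ... | _ , _ , refl | _ , ()
    zs-unique : Unique zs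
    zs-unique = Unique.++⁺ (Unique.map⁺ inj₂-injective ys-unique) (Unique.tabulate⁺ inj₁-injective) disjoint
    zs⊆S : ∀ {v} → v ∈ₗ zs → v ∈ᵛ S
    zs⊆S v∈zs with ∈-++⁻ (Data.List.map inj₂ ys) v∈zs
    ... | inj₁ v∈ys with ∈-map⁻ inj₂ v∈ys
    ...   | _ , y∈ys , refl = ys⊆S y∈ys
    zs⊆S v∈zs | inj₂ v∈outer with ∈-tabulate⁻ v∈outer
    ...   | i , refl = outer⊆S i
    length-zs : length zs ≡ length ys + r
    length-zs = trans (length-++ (Data.List.map inj₂ ys)) (cong₂ _+_ (length-map inj₂ ys) (length-tabulate outer))

  nonhubs-of-part≤∣S∣ : Geodetic G S → ∀ {i} → ¬ PairAway S i → 4 + r ≤ ∣ S ∣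
  nonhubs-of-part≤∣S∣ {S} S-geo {i} ¬away =
    ≤-trans (+-monoˡ-≤ r (m≤m+n 4 s))
            (subst (λ n → n + r ≤ ∣ S ∣) (length-tabulate nonhub)
                   (inner+outer≤∣S∣ (tabulate nonhub) (Unique.tabulate⁺ {f = nonhub} λ eq → suc-injective (,-injectiveʳ eq))
                                    nonhubs⊆S (outer⊆geodetic S-geo)))
    where
    nonhub : Fin k → Fin k × Fin (suc k)
    nonhub j = i , suc j
    nonhubs⊆S : ∀ {y} → y ∈ₗ tabulate nonhub → inj₂ y ∈ᵛ S
    nonhubs⊆S y∈ with ∈-tabulate⁻ {f = nonhub} y∈
    ... | j , refl = nonhubs⊆geodetic S-geo ¬away j

  two-pairs≤∣S∣ : Geodetic G S → ∀ {p p′} → p′ ≢ p → Pair S p → Pair S p′ → 4 + r ≤ ∣ S ∣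
  two-pairs≤∣S∣ {S} S-geo {p} {p′} p′≢p (j₁ , j₂ , j₁≢j₂ , ∈₁ , ∈₂) (j₃ , j₄ , j₃≢j₄ , ∈₃ , ∈₄) =
    inner+outer≤∣S∣ ((p , j₁) ∷ (p , j₂) ∷ (p′ , j₃) ∷ (p′ , j₄) ∷ []) unique four⊆S (outer⊆geodetic S-geo)
    where
    parts≢ : ∀ {j j′} → (p , j) ≢ (p′ , j′)
    parts≢ = p′≢p ∘ sym ∘ ,-injectiveˡ
    unique : Unique ((p , j₁) ∷ (p , j₂) ∷ (p′ , j₃) ∷ (p′ , j₄) ∷ [])
    unique = ((j₁≢j₂ ∘ ,-injectiveʳ) ∷ parts≢ ∷ parts≢ ∷ []) ∷ (parts≢ ∷ parts≢ ∷ []) ∷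
             ((j₃≢j₄ ∘ ,-injectiveʳ) ∷ []) ∷ [] ∷ []
    four⊆S : ∀ {y} → y ∈ₗ (p , j₁) ∷ (p , j₂) ∷ (p′ , j₃) ∷ (p′ , j₄) ∷ [] → inj₂ y ∈ᵛ S
    four⊆S (here refl)                         = ∈₁
    four⊆S (there (here refl))                 = ∈₂
    four⊆S (there (there (here refl)))         = ∈₃
    four⊆S (there (there (there (here refl)))) = ∈₄

  g-lower-bound : Geodetic G S → 4 + r ≤ ∣ S ∣
  g-lower-bound {S} S-geo with pair-away? S 0F
  ... | no ¬away = nonhubs-of-part≤∣S∣ S-geo ¬away
  ... | yes (p , _ , pair) with pair-away? S p
  ...   | no ¬away                 = nonhubs-of-part≤∣S∣ S-geo ¬away
  ...   | yes (p′ , p′≢p , pair′) = two-pairs≤∣S∣ S-geo p′≢p pair pair′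

  geodetic-basis : Fin (4 + r) → V
  geodetic-basis 0F                        = ⟨ 0F , 1F ⟩
  geodetic-basis 1F                        = ⟨ 0F , 2F ⟩
  geodetic-basis 2F                        = ⟨ 1F , 1F ⟩
  geodetic-basis 3F                        = ⟨ 1F , 2F ⟩
  geodetic-basis (suc (suc (suc (suc i)))) = outer i

  basis-geodetic : Geodetic G (image geodetic-basis)
  basis-geodetic = covered⇒geodetic covers
    where
    covers : ∀ v → Covered adjV (_∈ᵛ image geodetic-basis) v
    covers (outer i)     = inj₁ (∈-image⁺ geodetic-basis (suc (suc (suc (suc i)))))
    covers ⟨ 0F , _ ⟩    = inj₂ (_ , _ , ∈-image⁺ geodetic-basis 2F , ∈-image⁺ geodetic-basis 3F ,
                                 induced refl refl refl λ ())
    covers ⟨ suc _ , _ ⟩ = inj₂ (_ , _ , ∈-image⁺ geodetic-basis 0F , ∈-image⁺ geodetic-basis 1F ,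
                                 induced refl refl refl λ ())

  g : GeodeticNumber G (4 + r)
  g = (image geodetic-basis , basis-geodetic ,
       ≤-antisym (∣image∣≤ geodetic-basis) (g-lower-bound basis-geodetic)) , λ _ → g-lower-bound

  realization : Realizes k (4 + r)
  realization = G , connected , gp⁻ , g

necessity : ∀ {a b} → 2 ≤ a → Realizes a b → (2 ≤ a × a ≤ b) ⊎ (4 ≤ b × b ≤ a)
necessity {a} {b} 2≤a (G , _ , gp⁻ , g) with a ≤? b
... | yes a≤b = inj₁ (2≤a , a≤b)
... | no a≰b  = inj₂ (≰⇒> (a≰b ∘ SmallGeodeticNumber.gp⁻≤g G gp⁻ g) , <⇒≤ (≰⇒> a≰b))

sufficiency : ∀ {a b} → (2 ≤ a × a ≤ b) ⊎ (4 ≤ b × b ≤ a) → Realizes a b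
sufficiency (inj₁ (s≤s (s≤s _) , s≤s (s≤s q≤l))) = CompleteSplit.realization _ _ q≤l
sufficiency (inj₂ (4≤b , b≤a)) with ≤-trans 4≤b b≤a | 4≤b
... | s≤s (s≤s (s≤s (s≤s _))) | s≤s (s≤s (s≤s (s≤s _))) = HubbedMultipartite.realization _ _

theorem3p3 : (a b : ℕ) → 2 ≤ a → 2 ≤ b →
    (Σ Graph (λ G → Connected G × GpMinus G a × GeodeticNumber G b))
      ⇔ ((2 ≤ a × a ≤ b) ⊎ (4 ≤ b × b ≤ a))
theorem3p3 a b 2≤a _ = mk⇔ (necessity 2≤a) sufficiency
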